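{- Let $G$ be a non-trivial finite group and $m\geqslant2$. Then (1) the map $\tau\colon G^m\to G^m$, $(g_1,g_2,\dots,g_m)^\tau=(g_m,g_{m-1},\dots,g_1)$, is an automorphism of order $2$ of $\mathscr{G}_m(G)$; (2) the map $\omega\colon G^m\to G^m$, $(g_1,\dots,g_m)^\omega=(g_1^{ -1}g_2,g_1^{ -1}g_3,\dots,g_1^{ -1}g_m,g_1^{ -1})$, is an automorphism of order $m+1$ of $\mathscr{G}_m(G)$; (3) the subgroup $\mathbf{\Delta}_m=\langle\tau,\omega\rangle$ of $\mathbf{Aut}(\mathscr{G}_m(G))$ is isomorphic to the dihedral group $D_{m+1}$ of order $2m+2$.
   Context: For a finite group $G$ with identity $e$, $G^\times=G\setminus\{e\}$. For $x\in G^\times$ and $1\leqslant k<l\leqslant m+1$, $\mathbf{x}_{[k,l)}\in G^m$ has $j$-th coordinate $x$ for $k\leqslant j<l$ and $e$ otherwise; $\mathcal{S}$ is the set of all such $\mathbf{x}_{[k,l)}$, and $\mathscr{G}_m(G)=Cay(G^m,\mathcal{S})$ is the graph on $G^m$ with $\mathbf{g}\sim\mathbf{h}$ iff $\mathbf{h}\mathbf{g}^{ -1}\in\mathcal{S}$. Maps act on the right (exponential notation). -}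

module Defs where

open import Level using (Level; _⊔_)
open import Algebra.Bundles using (Group)
open import Data.Nat using (ℕ; zero; suc; _≤_; _<_; _∸_)
open import Data.Nat.DivMod using (_mod_)
open import Data.Fin using (Fin; toℕ; opposite)
import Data.Fin as F
open import Data.Maybe using (Maybe; just; nothing; maybe)
import Data.Maybe as M
open import Data.Bool using (Bool; true; false; _xor_)
open import Data.Product using (Σ; ∃; _×_; _,_)
open import Relation.Nullary using (¬_)

next : ∀ {n} → Fin (suc n) → Maybe (Fin (suc n))
next {zero}  F.zero    = nothing
next {suc n} F.zero    = just (F.suc F.zero)
next {suc n} (F.suc j) = M.map F.suc (next j)

-- The dihedral group D_k of order 2k, k = suc n:
-- the pair (a , b) stands for r^a s^b, with r^k = s^2 = 1, s r s = r^{-1}.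
-- Multiplication: r^a s^b · r^c s^d = r^(a + (-1)^b c) s^(b xor d).

Dihedral : ℕ → Set
Dihedral k = Fin k × Bool

dmul : ∀ n → Dihedral (suc n) → Dihedral (suc n) → Dihedral (suc n)
dmul n (a , false) (c , d) = ((toℕ a Data.Nat.+ toℕ c) mod suc n , d)
dmul n (a , true)  (c , d) = ((toℕ a Data.Nat.+ (suc n ∸ toℕ c)) mod suc n , Data.Bool.not d)

module GroupNotions {c ℓ : Level} (G : Group c ℓ) where
  open Group G

  IsFiniteGroup : Set (c ⊔ ℓ)
  IsFiniteGroup = Σ ℕ λ n → Σ (Fin n → Carrier) λ enum → ∀ x → ∃ λ i → enum i ≈ x

  NonTrivial : Set (c ⊔ ℓ)
  NonTrivial = Σ Carrier λ x → ¬ (x ≈ ε)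

module Cayley {c ℓ : Level} (G : Group c ℓ) (m : ℕ) where
  open Group G

  V : Set c
  V = Fin m → Carrier

  _≈V_ : V → V → Set ℓ
  g ≈V h = ∀ j → g j ≈ h j

  -- 𝐱_[k,l) with 0-based indices: coordinate j is x iff k ≤ j < l.
  -- (Corresponds to 1 ≤ k+1 < l+1 ≤ m+1 in the paper's 1-based notation.)
  IsInS : V → Set (c ⊔ ℓ)
  IsInS s = Σ Carrier λ x → ¬ (x ≈ ε) × Σ ℕ λ k → Σ ℕ λ l → k < l × l ≤ m ×
            (∀ j → (k ≤ toℕ j × toℕ j < l → s j ≈ x) × (¬ (k ≤ toℕ j × toℕ j < l) → s j ≈ ε))

  Adj : V → V → Set (c ⊔ ℓ)
  Adj g h = IsInS (λ j → h j ∙ (g j) ⁻¹)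

  IsAut : (V → V) → Set (c ⊔ ℓ)
  IsAut f = (∀ g h → g ≈V h → f g ≈V f h)
          × (∀ g h → f g ≈V f h → g ≈V h)
          × (∀ h → ∃ λ g → f g ≈V h)
          × (∀ g h → Adj g h → Adj (f g) (f h))
          × (∀ g h → Adj (f g) (f h) → Adj g h)

  _≈M_ : (V → V) → (V → V) → Set (c ⊔ ℓ)
  f ≈M f' = ∀ g → f g ≈V f' g

  idM : V → V
  idM g = g

  -- product in right-action convention: x^(f·g) = (x^f)^g
  _·_ : (V → V) → (V → V) → (V → V)
  (f · f') g = f' (f g)

  _^_ : (V → V) → ℕ → (V → V)
  f ^ zero  = idM
  f ^ suc n = f · (f ^ n)

  HasOrder : (V → V) → ℕ → Set (c ⊔ ℓ)
  HasOrder f k = 0 < k × (f ^ k) ≈M idM × (∀ i → 0 < i → i < k → ¬ ((f ^ i) ≈M idM))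

  τ : V → V
  τ g j = g (opposite j)

  -- ω: (g₁,…,g_m) ↦ (g₁⁻¹g₂, …, g₁⁻¹g_m, g₁⁻¹)   (identity if m = 0)
  ω : V → V
  ω = ω′ m
    where
    ω′ : ∀ k → (Fin k → Carrier) → (Fin k → Carrier)
    ω′ zero    g   = g
    ω′ (suc n) g j = maybe (λ i → (g F.zero) ⁻¹ ∙ g i) ((g F.zero) ⁻¹) (next j)

  data Gen (f₁ f₂ : V → V) : (V → V) → Set (c ⊔ ℓ) where
    gen-id   : Gen f₁ f₂ idM
    gen-f₁   : Gen f₁ f₂ f₁
    gen-f₂   : Gen f₁ f₂ f₂
    gen-mul  : ∀ {f f'} → Gen f₁ f₂ f → Gen f₁ f₂ f' → Gen f₁ f₂ (f · f')
    gen-inv  : ∀ {f f'} → Gen f₁ f₂ f → (f · f') ≈M idM → (f' · f) ≈M idM → Gen f₁ f₂ f'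
    gen-resp : ∀ {f f'} → Gen f₁ f₂ f → f ≈M f' → Gen f₁ f₂ f'

  IsoToDihedral : (V → V) → (V → V) → Set (c ⊔ ℓ)
  IsoToDihedral f₁ f₂ =
    Σ (Dihedral (suc m) → (V → V)) λ φ →
      (∀ d → Gen f₁ f₂ (φ d))
    × (∀ f → Gen f₁ f₂ f → ∃ λ d → φ d ≈M f)
    × (∀ d d' → φ d ≈M φ d' → d ≡ d')
    × (∀ d d' → φ (dmul m d d') ≈M (φ d · φ d'))
    where open import Relation.Binary.PropositionalEquality using (_≡_)

-- A vertex g of 𝒢_m(G) is the (m+1)-tuple (e, g₁, …, g_m) taken up to left multiplication
-- by a constant.  The dihedral group D_{m+1} acts on the positions ℤ/(m+1), hence on such
-- classes of tuples, and so on G^m; ω is the rotation i ↦ i + 1 and τ the reflection i ↦ -i.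
-- Adjacency g ∼ h says that h g⁻¹ is a nonidentity constant on an interval of positions and
-- e elsewhere: τ reverses the interval, while ω shifts it by one place and conjugates its
-- value, where an interval starting at the first position turns into its complement.  For
-- G ≠ 1 and m ≥ 2 the vertices with a single nonidentity entry show that the action is
-- faithful, so ⟨τ, ω⟩ is the image of D_{m+1} and isomorphic to it.
module Submission where

open import Defs
open import Level using (0ℓ; _⊔_)
open import Algebra.Bundles using (Group)
open import Data.Bool using (Bool; true; false; _xor_)
open import Data.Bool.Properties using (xor-assoc; xor-identityʳ)
open import Data.Empty using (⊥-elim)
open import Data.Fin using (Fin; toℕ; opposite)
import Data.Fin as F
open import Data.Fin.Properties
  using (toℕ-injective; toℕ<n; toℕ-fromℕ<; opposite-prop; opposite-involutive; punchInᵢ≢i)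
open import Data.Maybe using (Maybe; just; nothing; maybe)
open import Data.Nat using (ℕ; zero; suc; _+_; _∸_; _≤_; _<_; z≤n; s≤s; s≤s⁻¹; _%_; _≤?_; _<?_)
open import Data.Nat.DivMod using (_mod_; %-distribˡ-+; m%n%n≡m%n; m%n<n; m%n≤n; m<n⇒m%n≡m; n%n≡0)
open import Data.Nat.Properties
  using ( +-comm; +-assoc; +-identityʳ; m∸n+n≡m; +-∸-assoc; m∸n≤m; ∸-monoʳ-<
        ; m+n≤o⇒m≤o∸n; m≤o∸n⇒m+n≤o; ≤-refl; ≤-trans; n≤1+n; <⇒≤; <⇒≢; <⇒≱; ≮⇒≥; ≰⇒>)
open import Data.Nat.Tactic.RingSolver using (solve-∀)
open import Data.Product using (Σ; ∃; _×_; _,_; proj₁; proj₂)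
open import Function using (_∘_; id)
open import Function.Bundles using (_⇔_; mk⇔; Equivalence)
open import Relation.Binary.Bundles using (Setoid)
import Relation.Binary.Reasoning.Setoid as SetoidReasoning
open import Relation.Binary.PropositionalEquality as ≡ using (_≡_; _≢_; _≗_)
open import Relation.Nullary using (¬_; Dec; yes; no; _×-dec_)

module ModularArithmetic (N : ℕ) where

  n : ℕ
  n = suc N

  infix 4 _≋_
  record _≋_ (x y : ℕ) : Set where
    constructor mk
    field residue : x % n ≡ y % n

  ≋-setoid : Setoid 0ℓ 0ℓ
  ≋-setoid = record
    { _≈_ = _≋_
    ; isEquivalence = record
      { refl = mk ≡.refl
      ; sym = λ (mk p) → mk (≡.sym p)
      ; trans = λ (mk p) (mk q) → mk (≡.trans p q)
      }
    }

  open Setoid ≋-setoid public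
    using () renaming (refl to ≋-refl; sym to ≋-sym; trans to ≋-trans; reflexive to ≋-reflexive)

  +-≋-cong : ∀ {a a' b b'} → a ≋ a' → b ≋ b' → a + b ≋ a' + b'
  +-≋-cong {a} {a'} {b} {b'} (mk p) (mk q) = mk (begin
    (a + b) % n             ≡⟨ %-distribˡ-+ a b n ⟩
    (a % n + b % n) % n     ≡⟨ ≡.cong₂ (λ x y → (x + y) % n) p q ⟩
    (a' % n + b' % n) % n   ≡⟨ %-distribˡ-+ a' b' n ⟨
    (a' + b') % n           ∎)
    where open ≡.≡-Reasoning

  %-≋ : ∀ x → x % n ≋ x
  %-≋ x = mk (m%n%n≡m%n x n)

  n≋0 : n ≋ 0
  n≋0 = mk (n%n≡0 n)

  toℕ-mod-≋ : ∀ x → toℕ (x mod n) ≋ x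
  toℕ-mod-≋ x = ≋-trans (≋-reflexive (toℕ-fromℕ< (m%n<n x n))) (%-≋ x)

  toℕ-≋-injective : ∀ {i j : Fin n} → toℕ i ≋ toℕ j → i ≡ j
  toℕ-≋-injective {i} {j} (mk p) =
    toℕ-injective (≡.trans (≡.sym (m<n⇒m%n≡m (toℕ<n i))) (≡.trans p (m<n⇒m%n≡m (toℕ<n j))))

  -- additive inverse modulo n, represented in [1, n]: neg 0 is n, not 0
  neg : ℕ → ℕ
  neg x = n ∸ x % n

  neg-cong : ∀ {x y} → x ≋ y → neg x ≡ neg y
  neg-cong (mk p) = ≡.cong (n ∸_) p

  toℕ-neg : ∀ (i : Fin n) → n ∸ toℕ i ≡ neg (toℕ i)
  toℕ-neg i = ≡.cong (n ∸_) (≡.sym (m<n⇒m%n≡m (toℕ<n i)))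

  neg-inverseˡ : ∀ x → neg x + x ≋ 0
  neg-inverseˡ x = begin
    neg x + x      ≈⟨ +-≋-cong ≋-refl (%-≋ x) ⟨
    neg x + x % n  ≡⟨ m∸n+n≡m (m%n≤n x n) ⟩
    n              ≈⟨ n≋0 ⟩
    0              ∎
    where open SetoidReasoning ≋-setoid

  neg-inverseʳ : ∀ x → x + neg x ≋ 0
  neg-inverseʳ x = ≋-trans (≋-reflexive (+-comm x (neg x))) (neg-inverseˡ x)

  +-≋-cancelʳ : ∀ x y z → x + z ≋ y + z → x ≋ y
  +-≋-cancelʳ x y z p = begin
    x                ≡⟨ +-identityʳ x ⟨
    x + 0            ≈⟨ +-≋-cong ≋-refl (neg-inverseʳ z) ⟨
    x + (z + neg z)  ≡⟨ +-assoc x z (neg z) ⟨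
    x + z + neg z    ≈⟨ +-≋-cong p ≋-refl ⟩
    y + z + neg z    ≡⟨ +-assoc y z (neg z) ⟩
    y + (z + neg z)  ≈⟨ +-≋-cong ≋-refl (neg-inverseʳ z) ⟩
    y + 0            ≡⟨ +-identityʳ y ⟩
    y                ∎
    where open SetoidReasoning ≋-setoid

  neg-+ : ∀ x y → neg (x + y) ≋ neg x + neg y
  neg-+ x y = +-≋-cancelʳ _ _ (x + y) (begin
    neg (x + y) + (x + y)        ≈⟨ neg-inverseˡ (x + y) ⟩
    0                            ≈⟨ +-≋-cong (neg-inverseˡ x) (neg-inverseˡ y) ⟨
    (neg x + x) + (neg y + y)    ≡⟨ interchange (neg x) x (neg y) y ⟩
    (neg x + neg y) + (x + y)    ∎)
    where
    open SetoidReasoning ≋-setoid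
    interchange : ∀ a b c d → (a + b) + (c + d) ≡ (a + c) + (b + d)
    interchange = solve-∀

  neg-involutive : ∀ x → neg (neg x) ≋ x
  neg-involutive x = +-≋-cancelʳ _ _ (neg x)
    (≋-trans (neg-inverseˡ (neg x)) (≋-sym (neg-inverseʳ x)))

  signed : Bool → ℕ → ℕ
  signed false x = x
  signed true  x = neg x

  signed-cong : ∀ b {x y} → x ≋ y → signed b x ≋ signed b y
  signed-cong false p = p
  signed-cong true  p = ≋-reflexive (neg-cong p)

  signed-+ : ∀ b x y → signed b (x + y) ≋ signed b x + signed b y
  signed-+ false x y = ≋-refl
  signed-+ true  x y = neg-+ x y

  signed-signed : ∀ b b' x → signed b (signed b' x) ≋ signed (b xor b') x
  signed-signed false b'    x = ≋-refl
  signed-signed true  false x = ≋-refl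
  signed-signed true  true  x = neg-involutive x

  signed-0 : ∀ b → signed b 0 ≋ 0
  signed-0 false = ≋-refl
  signed-0 true  = n≋0

module DihedralGroup (N : ℕ) where
  open ModularArithmetic N public

  D : Set
  D = Dihedral n

  infixl 7 _⊛_
  _⊛_ : D → D → D
  _⊛_ = dmul N

  e : D
  e = (F.zero , false)

  inv : D → D
  inv (a , false) = (neg (toℕ a) mod n , false)
  inv (a , true)  = (a , true)

  D-≡ : ∀ {a a' : Fin n} {b b' : Bool} → toℕ a ≋ toℕ a' → b ≡ b' → (a , b) ≡ (a' , b')
  D-≡ p ≡.refl = ≡.cong (_, _) (toℕ-≋-injective p)

  ⊛-proj₁ : ∀ x y → toℕ (proj₁ (x ⊛ y)) ≋ toℕ (proj₁ x) + signed (proj₂ x) (toℕ (proj₁ y))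
  ⊛-proj₁ (a , false) (c , _) = toℕ-mod-≋ (toℕ a + toℕ c)
  ⊛-proj₁ (a , true)  (c , _) =
    ≋-trans (toℕ-mod-≋ (toℕ a + (n ∸ toℕ c))) (≋-reflexive (≡.cong (toℕ a +_) (toℕ-neg c)))

  ⊛-proj₂ : ∀ x y → proj₂ (x ⊛ y) ≡ proj₂ x xor proj₂ y
  ⊛-proj₂ (a , false) y = ≡.refl
  ⊛-proj₂ (a , true)  y = ≡.refl

  ⊛-proj₁-independent : ∀ x c b b' → proj₁ (x ⊛ (c , b)) ≡ proj₁ (x ⊛ (c , b'))
  ⊛-proj₁-independent (a , false) c b b' = ≡.refl
  ⊛-proj₁-independent (a , true)  c b b' = ≡.refl

  ⊛-assoc : ∀ x y z → (x ⊛ y) ⊛ z ≡ x ⊛ (y ⊛ z)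
  ⊛-assoc x@(a , b) y@(c , b') z@(d , b'') = D-≡ rotation-part reflection-part
    where
    A = toℕ a
    C = toℕ c
    E = toℕ d

    rotation-part : toℕ (proj₁ ((x ⊛ y) ⊛ z)) ≋ toℕ (proj₁ (x ⊛ (y ⊛ z)))
    rotation-part = begin
      toℕ (proj₁ ((x ⊛ y) ⊛ z))                       ≈⟨ ⊛-proj₁ (x ⊛ y) z ⟩
      toℕ (proj₁ (x ⊛ y)) + signed (proj₂ (x ⊛ y)) E  ≈⟨ +-≋-cong (⊛-proj₁ x y) (≋-reflexive sign-xy) ⟩
      (A + signed b C) + signed (b xor b') E          ≡⟨ +-assoc A _ _ ⟩
      A + (signed b C + signed (b xor b') E)          ≈⟨ +-≋-cong (≋-refl {A}) (+-≋-cong ≋-refl (signed-signed b b' E)) ⟨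
      A + (signed b C + signed b (signed b' E))       ≈⟨ +-≋-cong (≋-refl {A}) (signed-+ b C (signed b' E)) ⟨
      A + signed b (C + signed b' E)                  ≈⟨ +-≋-cong (≋-refl {A}) (signed-cong b (⊛-proj₁ y z)) ⟨
      A + signed b (toℕ (proj₁ (y ⊛ z)))              ≈⟨ ⊛-proj₁ x (y ⊛ z) ⟨
      toℕ (proj₁ (x ⊛ (y ⊛ z)))                       ∎
      where
      open SetoidReasoning ≋-setoid
      sign-xy : signed (proj₂ (x ⊛ y)) E ≡ signed (b xor b') E
      sign-xy = ≡.cong (λ β → signed β E) (⊛-proj₂ x y)

    reflection-part : proj₂ ((x ⊛ y) ⊛ z) ≡ proj₂ (x ⊛ (y ⊛ z))
    reflection-part = begin
      proj₂ ((x ⊛ y) ⊛ z)      ≡⟨ ⊛-proj₂ (x ⊛ y) z ⟩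
      proj₂ (x ⊛ y) xor b''    ≡⟨ ≡.cong (_xor b'') (⊛-proj₂ x y) ⟩
      (b xor b') xor b''       ≡⟨ xor-assoc b b' b'' ⟩
      b xor (b' xor b'')       ≡⟨ ≡.cong (b xor_) (⊛-proj₂ y z) ⟨
      b xor proj₂ (y ⊛ z)      ≡⟨ ⊛-proj₂ x (y ⊛ z) ⟨
      proj₂ (x ⊛ (y ⊛ z))      ∎
      where open ≡.≡-Reasoning

  ⊛-identityˡ : ∀ x → e ⊛ x ≡ x
  ⊛-identityˡ x = D-≡ (⊛-proj₁ e x) ≡.refl

  ⊛-identityʳ : ∀ x → x ⊛ e ≡ x
  ⊛-identityʳ x@(a , b) = D-≡
    (≋-trans (⊛-proj₁ x e) (≋-trans (+-≋-cong ≋-refl (signed-0 b)) (≋-reflexive (+-identityʳ (toℕ a)))))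
    (≡.trans (⊛-proj₂ x e) (xor-identityʳ b))

  ⊛-inverseʳ : ∀ x → x ⊛ inv x ≡ e
  ⊛-inverseʳ x@(a , false) = D-≡
    (≋-trans (⊛-proj₁ x (inv x)) (≋-trans (+-≋-cong ≋-refl (toℕ-mod-≋ (neg (toℕ a)))) (neg-inverseʳ (toℕ a))))
    ≡.refl
  ⊛-inverseʳ x@(a , true) = D-≡ (≋-trans (⊛-proj₁ x x) (neg-inverseʳ (toℕ a))) ≡.refl

  ⊛-inverseˡ : ∀ x → inv x ⊛ x ≡ e
  ⊛-inverseˡ x@(a , false) = D-≡
    (≋-trans (⊛-proj₁ (inv x) x) (≋-trans (+-≋-cong (toℕ-mod-≋ (neg (toℕ a))) ≋-refl) (neg-inverseˡ (toℕ a))))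
    ≡.refl
  ⊛-inverseˡ x@(a , true) = ⊛-inverseʳ x

  ⊛-inverse-unique : ∀ x y → x ⊛ inv y ≡ e → x ≡ y
  ⊛-inverse-unique x y p = begin
    x                 ≡⟨ ⊛-identityʳ x ⟨
    x ⊛ e             ≡⟨ ≡.cong (x ⊛_) (⊛-inverseˡ y) ⟨
    x ⊛ (inv y ⊛ y)   ≡⟨ ⊛-assoc x (inv y) y ⟨
    x ⊛ inv y ⊛ y     ≡⟨ ≡.cong (_⊛ y) p ⟩
    e ⊛ y             ≡⟨ ⊛-identityˡ y ⟩
    y                 ∎
    where open ≡.≡-Reasoning

  act : D → Fin n → Fin n
  act d i = proj₁ (d ⊛ (i , false))

  act-≋ : ∀ d i → toℕ (act d i) ≋ toℕ (proj₁ d) + signed (proj₂ d) (toℕ i)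
  act-≋ d i = ⊛-proj₁ d (i , false)

  act-⊛ : ∀ d d' i → act (d ⊛ d') i ≡ act d (act d' i)
  act-⊛ d d' i = ≡.trans (≡.cong proj₁ (⊛-assoc d d' (i , false)))
    (⊛-proj₁-independent d (act d' i) (proj₂ (d' ⊛ (i , false))) false)

  act-e : ∀ i → act e i ≡ i
  act-e i = toℕ-≋-injective (act-≋ e i)

  act-inv : ∀ d i → act (inv d) (act d i) ≡ i
  act-inv d i = ≡.trans (≡.sym (act-⊛ (inv d) d i))
    (≡.trans (≡.cong (λ d' → act d' i) (⊛-inverseˡ d)) (act-e i))

  act-injective : ∀ d {i j} → act d i ≡ act d j → i ≡ j
  act-injective d {i} {j} p = ≡.trans (≡.sym (act-inv d i)) (≡.trans (≡.cong (act (inv d)) p) (act-inv d j))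

  act-zero : ∀ d → act d F.zero ≡ proj₁ d
  act-zero d@(a , b) = toℕ-≋-injective
    (≋-trans (act-≋ d F.zero) (≋-trans (+-≋-cong ≋-refl (signed-0 b)) (≋-reflexive (+-identityʳ (toℕ a)))))

distinct-index : ∀ {m} → 2 ≤ m → (a : Fin m) → Σ (Fin m) (_≢ a)
distinct-index {suc (suc k)} (s≤s (s≤s z≤n)) a = F.punchIn a F.zero , punchInᵢ≢i a F.zero

module GroupFacts {c ℓ} (G : Group c ℓ) where
  open Group G
  open import Algebra.Properties.Group G

  ε⁻¹∙x≈x : ∀ x → ε ⁻¹ ∙ x ≈ x
  ε⁻¹∙x≈x x = trans (∙-congʳ ε⁻¹≈ε) (identityˡ x)

  ⁻¹≈ε⇒≈ε : ∀ {y} → y ⁻¹ ≈ ε → y ≈ ε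
  ⁻¹≈ε⇒≈ε p = ⁻¹-injective (trans p (sym ε⁻¹≈ε))

  x⁻¹∙[x∙y]≈y : ∀ x y → x ⁻¹ ∙ (x ∙ y) ≈ y
  x⁻¹∙[x∙y]≈y x y = trans (sym (assoc _ _ _)) (trans (∙-congʳ (inverseˡ x)) (identityˡ y))

  [a⁻¹∙x]⁻¹∙[a⁻¹∙y]≈x⁻¹∙y : ∀ a x y → (a ⁻¹ ∙ x) ⁻¹ ∙ (a ⁻¹ ∙ y) ≈ x ⁻¹ ∙ y
  [a⁻¹∙x]⁻¹∙[a⁻¹∙y]≈x⁻¹∙y a x y = begin
    (a ⁻¹ ∙ x) ⁻¹ ∙ (a ⁻¹ ∙ y)      ≈⟨ ∙-congʳ (⁻¹-anti-homo-∙ (a ⁻¹) x) ⟩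
    (x ⁻¹ ∙ a ⁻¹ ⁻¹) ∙ (a ⁻¹ ∙ y)   ≈⟨ assoc _ _ _ ⟩
    x ⁻¹ ∙ (a ⁻¹ ⁻¹ ∙ (a ⁻¹ ∙ y))   ≈⟨ ∙-congˡ (x⁻¹∙[x∙y]≈y (a ⁻¹) y) ⟩
    x ⁻¹ ∙ y                        ∎
    where open SetoidReasoning setoid

  conj : Carrier → Carrier → Carrier
  conj c y = c ⁻¹ ∙ y ∙ c

  conj-cong : ∀ c {y z} → y ≈ z → conj c y ≈ conj c z
  conj-cong c y≈z = ∙-congʳ (∙-congˡ y≈z)

  conj-ε : ∀ c → conj c ε ≈ ε
  conj-ε c = trans (∙-congʳ (identityʳ (c ⁻¹))) (inverseˡ c)

  conj≈ε⇒≈ε : ∀ c {y} → conj c y ≈ ε → y ≈ ε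
  conj≈ε⇒≈ε c {y} p = begin
    y                   ≈⟨ identityˡ y ⟨
    ε ∙ y               ≈⟨ ∙-congʳ (inverseʳ c) ⟨
    (c ∙ c ⁻¹) ∙ y      ≈⟨ assoc c (c ⁻¹) y ⟩
    c ∙ (c ⁻¹ ∙ y)      ≈⟨ ∙-congˡ (inverseˡ-unique _ c p) ⟩
    c ∙ c ⁻¹            ≈⟨ inverseʳ c ⟩
    ε                   ∎
    where open SetoidReasoning setoid

  left-normalised-quotient : ∀ a b y z → (a ⁻¹ ∙ y) ∙ (b ⁻¹ ∙ z) ⁻¹ ≈ conj b ((a ∙ b ⁻¹) ⁻¹ ∙ (y ∙ z ⁻¹))
  left-normalised-quotient a b y z = begin
    (a ⁻¹ ∙ y) ∙ (b ⁻¹ ∙ z) ⁻¹            ≈⟨ ∙-congˡ (trans (⁻¹-anti-homo-∙ (b ⁻¹) z) (∙-congˡ (⁻¹-involutive b))) ⟩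
    (a ⁻¹ ∙ y) ∙ (z ⁻¹ ∙ b)               ≈⟨ assoc (a ⁻¹) y _ ⟩
    a ⁻¹ ∙ (y ∙ (z ⁻¹ ∙ b))               ≈⟨ ∙-congˡ (assoc y (z ⁻¹) b) ⟨
    a ⁻¹ ∙ ((y ∙ z ⁻¹) ∙ b)               ≈⟨ assoc (a ⁻¹) _ b ⟨
    (a ⁻¹ ∙ (y ∙ z ⁻¹)) ∙ b               ≈⟨ ∙-congʳ (x⁻¹∙[x∙y]≈y b _) ⟨
    b ⁻¹ ∙ (b ∙ (a ⁻¹ ∙ (y ∙ z ⁻¹))) ∙ b  ≈⟨ ∙-congʳ (∙-congˡ (assoc b (a ⁻¹) _)) ⟨
    b ⁻¹ ∙ ((b ∙ a ⁻¹) ∙ (y ∙ z ⁻¹)) ∙ b  ≈⟨ conj-cong b (∙-congʳ inverse-of-quotient) ⟨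
    conj b ((a ∙ b ⁻¹) ⁻¹ ∙ (y ∙ z ⁻¹))   ∎
    where
    open SetoidReasoning setoid
    inverse-of-quotient : (a ∙ b ⁻¹) ⁻¹ ≈ b ∙ a ⁻¹
    inverse-of-quotient = trans (⁻¹-anti-homo-∙ a (b ⁻¹)) (∙-congʳ (⁻¹-involutive b))

module Relabelling {c ℓ} (G : Group c ℓ) (m : ℕ) where
  open Group G
  open GroupFacts G
  open Cayley G m using (V; _≈V_)
  import Data.Vec.Functional.Relation.Binary.Pointwise.Properties as Pointwise
  open Setoid (Pointwise.setoid setoid m) public
    using () renaming (refl to ≈V-refl; sym to ≈V-sym; trans to ≈V-trans)

  pad : V → Fin (suc m) → Carrier
  pad g F.zero    = ε
  pad g (F.suc j) = g j

  relabel : (Fin (suc m) → Fin (suc m)) → V → V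
  relabel s g j = pad g (s F.zero) ⁻¹ ∙ pad g (s (F.suc j))

  pad-cong : ∀ {g h} → g ≈V h → ∀ i → pad g i ≈ pad h i
  pad-cong p F.zero    = refl
  pad-cong p (F.suc j) = p j

  relabel-cong : ∀ s {g h} → g ≈V h → relabel s g ≈V relabel s h
  relabel-cong s p j = ∙-cong (⁻¹-cong (pad-cong p (s F.zero))) (pad-cong p (s (F.suc j)))

  relabel-ext : ∀ {s s'} → s ≗ s' → ∀ g → relabel s g ≈V relabel s' g
  relabel-ext e g j = reflexive (≡.cong₂ (λ a b → pad g a ⁻¹ ∙ pad g b) (e F.zero) (e (F.suc j)))

  pad-relabel : ∀ s g i → pad (relabel s g) i ≈ pad g (s F.zero) ⁻¹ ∙ pad g (s i)
  pad-relabel s g F.zero    = sym (inverseˡ _)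
  pad-relabel s g (F.suc j) = refl

  relabel-∘ : ∀ r s g → relabel r (relabel s g) ≈V relabel (s ∘ r) g
  relabel-∘ r s g j = begin
    pad (relabel s g) (r F.zero) ⁻¹ ∙ pad (relabel s g) (r (F.suc j))
      ≈⟨ ∙-cong (⁻¹-cong (pad-relabel s g _)) (pad-relabel s g _) ⟩
    (pad g (s F.zero) ⁻¹ ∙ pad g (s (r F.zero))) ⁻¹ ∙ (pad g (s F.zero) ⁻¹ ∙ pad g (s (r (F.suc j))))
      ≈⟨ [a⁻¹∙x]⁻¹∙[a⁻¹∙y]≈x⁻¹∙y _ _ _ ⟩
    pad g (s (r F.zero)) ⁻¹ ∙ pad g (s (r (F.suc j)))
      ∎
    where open SetoidReasoning setoid

  relabel-id : ∀ g → relabel id g ≈V g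
  relabel-id g j = ε⁻¹∙x≈x (g j)

  module Faithfulness (x : Carrier) (x≉ε : ¬ x ≈ ε) where

    δ : Fin m → V
    δ p j with j F.≟ p
    ... | yes _ = x
    ... | no  _ = ε

    δ-hit : ∀ p → δ p p ≈ x
    δ-hit p with p F.≟ p
    ... | yes _  = refl
    ... | no p≢p = ⊥-elim (p≢p ≡.refl)

    δ-miss : ∀ {p j} → j ≢ p → δ p j ≈ ε
    δ-miss {p} {j} j≢p with j F.≟ p
    ... | yes j≡p = ⊥-elim (j≢p j≡p)
    ... | no  _   = refl

    pad-δ-miss : ∀ {p} i → i ≢ F.suc p → pad (δ p) i ≈ ε
    pad-δ-miss F.zero    _  = refl
    pad-δ-miss (F.suc j) ne = δ-miss (ne ∘ ≡.cong F.suc)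

    relabel-faithful : 2 ≤ m → ∀ {s} → (∀ {i j} → s i ≡ s j → i ≡ j) →
                       (∀ g → relabel s g ≈V g) → ∀ i → s i ≡ i
    relabel-faithful 2≤m {s} s-injective s-trivial = fixes
      where
      open SetoidReasoning setoid

      s-suc≢s-zero : ∀ j → s (F.suc j) ≢ s F.zero
      s-suc≢s-zero j eq with s-injective eq
      ... | ()

      image-of-zero : ∀ i → s F.zero ≡ i → i ≡ F.zero
      image-of-zero F.zero    _  = ≡.refl
      image-of-zero (F.suc a) s0 = ⊥-elim (x≉ε (⁻¹≈ε⇒≈ε (begin
        x ⁻¹                                               ≈⟨ identityʳ (x ⁻¹) ⟨
        x ⁻¹ ∙ ε                                           ≈⟨ ∙-cong (⁻¹-cong pad-s0) pad-sj ⟨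
        pad (δ a) (s F.zero) ⁻¹ ∙ pad (δ a) (s (F.suc j))  ≈⟨ s-trivial (δ a) j ⟩
        δ a j                                              ≈⟨ δ-miss j≢a ⟩
        ε                                                  ∎)))
        where
        j = proj₁ (distinct-index 2≤m a)
        j≢a = proj₂ (distinct-index 2≤m a)
        pad-s0 : pad (δ a) (s F.zero) ≈ x
        pad-s0 = trans (reflexive (≡.cong (pad (δ a)) s0)) (δ-hit a)
        pad-sj : pad (δ a) (s (F.suc j)) ≈ ε
        pad-sj = pad-δ-miss _ (λ eq → s-suc≢s-zero j (≡.trans eq (≡.sym s0)))

      fixes-zero : s F.zero ≡ F.zero
      fixes-zero = image-of-zero (s F.zero) ≡.refl

      fixes : ∀ i → s i ≡ i
      fixes F.zero = fixes-zero
      fixes (F.suc j) with s (F.suc j) F.≟ F.suc j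
      ... | yes fixed = fixed
      ... | no  moved = ⊥-elim (x≉ε (begin
        x                                                ≈⟨ δ-hit j ⟨
        δ j j                                            ≈⟨ s-trivial (δ j) j ⟨
        pad (δ j) (s F.zero) ⁻¹ ∙ pad (δ j) (s (F.suc j))
          ≈⟨ ∙-cong (⁻¹-cong (pad-δ-miss _ zero≢)) (pad-δ-miss _ moved) ⟩
        ε ⁻¹ ∙ ε                                         ≈⟨ ε⁻¹∙x≈x ε ⟩
        ε                                                ∎))
        where
        zero≢ : s F.zero ≢ F.suc j
        zero≢ eq with ≡.trans (≡.sym fixes-zero) eq
        ... | ()

module Blocks {c ℓ} (G : Group c ℓ) (m : ℕ) where
  open Group G
  open GroupFacts G
  open Cayley G m using (V; _≈V_; IsInS)

  BlockOn : (Fin m → Set) → Carrier → V → Set ℓ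
  BlockOn P x s = ∀ j → (P j → s j ≈ x) × (¬ P j → s j ≈ ε)

  Interval : ℕ → ℕ → Fin m → Set
  Interval k l j = k ≤ toℕ j × toℕ j < l

  BlockOn-⇔ : ∀ {P Q x s} → (∀ j → P j ⇔ Q j) → BlockOn P x s → BlockOn Q x s
  BlockOn-⇔ P⇔Q blk j = proj₁ (blk j) ∘ Equivalence.from (P⇔Q j) , proj₂ (blk j) ∘ (_∘ Equivalence.to (P⇔Q j))

  BlockOn-resp : ∀ {P x s s'} → s ≈V s' → BlockOn P x s → BlockOn P x s'
  BlockOn-resp s≈s' blk j = trans (sym (s≈s' j)) ∘ proj₁ (blk j) , trans (sym (s≈s' j)) ∘ proj₂ (blk j)

  BlockOn-map : ∀ {P x s} (f : Carrier → Carrier) → (∀ {y z} → y ≈ z → f y ≈ f z) → f ε ≈ ε →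
                BlockOn P x s → BlockOn P (f x) (f ∘ s)
  BlockOn-map f f-cong fε≈ε blk j = f-cong ∘ proj₁ (blk j) , λ ¬p → trans (f-cong (proj₂ (blk j) ¬p)) fε≈ε

  BlockOn-complement : ∀ {P x s} → (∀ j → Dec (P j)) → BlockOn P x s →
                       BlockOn (¬_ ∘ P) (x ⁻¹) (λ j → x ⁻¹ ∙ s j)
  BlockOn-complement {P} {x} {s} P? blk j = outside , inside
    where
    outside : ¬ P j → x ⁻¹ ∙ s j ≈ x ⁻¹
    outside ¬p = trans (∙-congˡ (proj₂ (blk j) ¬p)) (identityʳ (x ⁻¹))
    inside : ¬ ¬ P j → x ⁻¹ ∙ s j ≈ ε
    inside ¬¬p with P? j
    ... | yes p = trans (∙-congˡ (proj₁ (blk j) p)) (inverseˡ x)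
    ... | no ¬p = ⊥-elim (¬¬p ¬p)

  IsInS-resp : ∀ {s s'} → s ≈V s' → IsInS s → IsInS s'
  IsInS-resp s≈s' (x , x≉ε , k , l , k<l , l≤m , blk) = x , x≉ε , k , l , k<l , l≤m , BlockOn-resp s≈s' blk

  reverse-interval : ∀ {k l} → k ≤ m → l ≤ m → ∀ j →
                     Interval k l (opposite j) ⇔ Interval (m ∸ l) (m ∸ k) j
  reverse-interval {k} {l} k≤m l≤m j = mk⇔
    (λ (k≤o , o<l) → ≮⇒≥ (λ j<m∸l → <⇒≱ o<l (from (lower l≤m) j<m∸l)) , to (lower k≤m) k≤o)
    (λ (m∸l≤j , j<m∸k) → from (lower k≤m) j<m∸k , ≰⇒> (λ l≤o → <⇒≱ (to (lower l≤m) l≤o) m∸l≤j))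
    where
    j<m = toℕ<n j
    -- k ≤ m ∸ (1 + j) and 1 + j ≤ m ∸ k both say k + (1 + j) ≤ m
    lower : ∀ {a} → a ≤ m → (a ≤ toℕ (opposite j)) ⇔ (toℕ j < m ∸ a)
    lower {a} a≤m = mk⇔
      (λ a≤o → m+n≤o⇒m≤o∸n (suc (toℕ j))
        (≡.subst (_≤ m) (+-comm a (suc (toℕ j))) (m≤o∸n⇒m+n≤o a j<m (≡.subst (a ≤_) (opposite-prop j) a≤o))))
      (λ j<m∸a → ≡.subst (a ≤_) (≡.sym (opposite-prop j)) (m+n≤o⇒m≤o∸n a
        (≡.subst (_≤ m) (+-comm (suc (toℕ j)) a) (m≤o∸n⇒m+n≤o (suc (toℕ j)) a≤m j<m∸a))))
    open Equivalence

  IsInS-reverse : ∀ {s} → IsInS s → IsInS (s ∘ opposite)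
  IsInS-reverse (x , x≉ε , k , l , k<l , l≤m , blk) =
    x , x≉ε , m ∸ l , m ∸ k , ∸-monoʳ-< k<l l≤m , m∸n≤m m k ,
    BlockOn-⇔ (reverse-interval (≤-trans (<⇒≤ k<l) l≤m) l≤m) (blk ∘ opposite)

  IsInS-conj : ∀ c {s} → IsInS s → IsInS (conj c ∘ s)
  IsInS-conj c (x , x≉ε , k , l , k<l , l≤m , blk) =
    conj c x , x≉ε ∘ conj≈ε⇒≈ε c , k , l , k<l , l≤m , BlockOn-map (conj c) (conj-cong c) (conj-ε c) blk

data NextSpec {k} (j : Fin (suc k)) : Maybe (Fin (suc k)) → Set where
  next-suc  : ∀ i → toℕ i ≡ suc (toℕ j) → NextSpec j (just i)
  next-last : toℕ j ≡ k → NextSpec j nothing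

next-spec : ∀ {k} (j : Fin (suc k)) → NextSpec j (next j)
next-spec {zero}  F.zero = next-last ≡.refl
next-spec {suc k} F.zero = next-suc (F.suc F.zero) ≡.refl
next-spec {suc k} (F.suc j) with next j | next-spec j
... | just i  | next-suc .i p = next-suc (F.suc i) (≡.cong suc p)
... | nothing | next-last p   = next-last (≡.cong suc p)

module Rotation {c ℓ} (G : Group c ℓ) (m′ : ℕ) where
  open Group G
  open import Algebra.Properties.Group G using (ε⁻¹≈ε)
  open GroupFacts G
  open Cayley G (suc m′) using (V; _≈V_; IsInS; Adj; ω)
  open Blocks G (suc m′)

  -- entry 1 + j of s, where s is extended by ε at position m
  shifted : V → V
  shifted s j = maybe s ε (next j)

  shifted-BlockOn : ∀ {k l x s} → l ≤ suc m′ → BlockOn (Interval k l) x s →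
                    BlockOn (λ j → k ≤ suc (toℕ j) × suc (toℕ j) < l) x (shifted s)
  shifted-BlockOn {k} {l} l≤m blk j with next j | next-spec j
  ... | just i  | next-suc .i i≡1+j =
    proj₁ (blk i) ∘ ≡.subst P (≡.sym i≡1+j) , (λ ¬p → proj₂ (blk i) (¬p ∘ ≡.subst P i≡1+j))
    where P = λ t → k ≤ t × t < l
  ... | nothing | next-last j≡m′ =
    (λ (_ , 1+j<l) → ⊥-elim (<⇒≱ 1+j<l (≡.subst (l ≤_) (≡.sym (≡.cong suc j≡m′)) l≤m))) , λ _ → refl

  IsInS-shift : ∀ {s} → IsInS s → IsInS (λ j → s F.zero ⁻¹ ∙ shifted s j)
  IsInS-shift {s} (x , x≉ε , zero , suc l , _ , l≤m , blk) =
    x ⁻¹ , x≉ε ∘ ⁻¹≈ε⇒≈ε , l , suc m′ , l≤m , ≤-refl ,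
    BlockOn-resp (λ j → ∙-congʳ (⁻¹-cong (sym s₀≈x)))
      (BlockOn-⇔ complement⇔interval (BlockOn-complement inside? (shifted-BlockOn l≤m blk)))
    where
    s₀≈x : s F.zero ≈ x
    s₀≈x = proj₁ (blk F.zero) (z≤n , s≤s z≤n)
    inside? : ∀ j → Dec (0 ≤ suc (toℕ j) × suc (toℕ j) < suc l)
    inside? j = (0 ≤? suc (toℕ j)) ×-dec (suc (toℕ j) <? suc l)
    complement⇔interval : ∀ j → (¬ (0 ≤ suc (toℕ j) × suc (toℕ j) < suc l)) ⇔ Interval l (suc m′) j
    complement⇔interval j = mk⇔
      (λ outside → ≮⇒≥ (λ j<l → outside (z≤n , s≤s j<l)) , toℕ<n j)
      (λ (l≤j , _) (_ , 1+j<1+l) → <⇒≱ (s≤s⁻¹ 1+j<1+l) l≤j)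
  IsInS-shift {s} (x , x≉ε , suc k , suc l , k<l , l≤m , blk) =
    x , x≉ε , k , l , s≤s⁻¹ k<l , ≤-trans (n≤1+n l) l≤m ,
    BlockOn-resp (λ j → sym (trans (∙-congʳ (trans (⁻¹-cong s₀≈ε) ε⁻¹≈ε)) (identityˡ _)))
      (BlockOn-⇔ (λ j → mk⇔ (λ (a , b) → s≤s⁻¹ a , s≤s⁻¹ b) (λ (a , b) → s≤s a , s≤s b))
        (shifted-BlockOn l≤m blk))
    where
    s₀≈ε : s F.zero ≈ ε
    s₀≈ε = proj₂ (blk F.zero) (λ ())
  IsInS-shift (_ , _ , zero  , zero , () , _)
  IsInS-shift (_ , _ , suc _ , zero , () , _)

  ω-shifted : ∀ g j → ω g j ≈ g F.zero ⁻¹ ∙ shifted g j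
  ω-shifted g j with next j
  ... | just i  = refl
  ... | nothing = sym (identityʳ _)

  shifted-quotient : ∀ g h j → shifted h j ∙ shifted g j ⁻¹ ≈ shifted (λ i → h i ∙ g i ⁻¹) j
  shifted-quotient g h j with next j
  ... | just i  = refl
  ... | nothing = trans (∙-congˡ ε⁻¹≈ε) (identityʳ ε)

  ω-quotient : ∀ g h j → let s = λ i → h i ∙ g i ⁻¹ in
               ω h j ∙ ω g j ⁻¹ ≈ conj (g F.zero) (s F.zero ⁻¹ ∙ shifted s j)
  ω-quotient g h j = trans (∙-cong (ω-shifted h j) (⁻¹-cong (ω-shifted g j)))
    (trans (left-normalised-quotient (h F.zero) (g F.zero) _ _)
      (conj-cong (g F.zero) (∙-congˡ (shifted-quotient g h j))))

  ω-preserves-Adj : ∀ g h → Adj g h → Adj (ω g) (ω h)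
  ω-preserves-Adj g h g∼h =
    IsInS-resp (λ j → sym (ω-quotient g h j)) (IsInS-conj (g F.zero) (IsInS-shift g∼h))

module DihedralAction {c ℓ} (G : Group c ℓ) (m₀ : ℕ) where
  open Group G
  open GroupFacts G using (ε⁻¹∙x≈x)
  open Cayley G (suc (suc m₀))
  open DihedralGroup (suc (suc m₀))
  open Relabelling G (suc (suc m₀))
  open Blocks G (suc (suc m₀)) using (IsInS-resp; IsInS-reverse)
  open Rotation G (suc m₀) using (ω-shifted)

  rotation reflection : D
  rotation   = (F.suc F.zero , false)
  reflection = (F.zero , true)

  act-rotation : ∀ j → act rotation (F.suc j) ≡ maybe F.suc F.zero (next j)
  act-rotation j with next j | next-spec j
  ... | just i  | next-suc .i i≡1+j = toℕ-≋-injective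
    (≋-trans (act-≋ rotation (F.suc j)) (≋-reflexive (≡.cong suc (≡.sym i≡1+j))))
  ... | nothing | next-last j≡m₀ = toℕ-≋-injective
    (≋-trans (act-≋ rotation (F.suc j)) (≋-trans (≋-reflexive (≡.cong (suc ∘ suc) j≡m₀)) n≋0))

  act-reflection : ∀ j → act reflection (F.suc j) ≡ F.suc (opposite j)
  act-reflection j = toℕ-≋-injective (≋-trans (act-≋ reflection (F.suc j)) (≋-reflexive (begin
    neg (suc (toℕ j))             ≡⟨ toℕ-neg (F.suc j) ⟨
    n ∸ suc (toℕ j)               ≡⟨ +-∸-assoc 1 (toℕ<n j) ⟩
    suc (suc (suc m₀) ∸ suc (toℕ j)) ≡⟨ ≡.cong suc (opposite-prop j) ⟨
    suc (toℕ (opposite j))        ∎)))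
    where open ≡.≡-Reasoning

  act-trivial : ∀ d → (∀ i → act d i ≡ i) → d ≡ e
  act-trivial d@(a , b) fixes with ≡.trans (≡.sym (act-zero d)) (fixes F.zero)
  act-trivial (.F.zero , false) fixes | ≡.refl = ≡.refl
  act-trivial (.F.zero , true)  fixes | ≡.refl
    with ≡.trans (≡.sym (act-reflection F.zero)) (fixes (F.suc F.zero))
  ... | ()

  φ : D → V → V
  φ d = relabel (act d)

  φ-cong : ∀ d {g h} → g ≈V h → φ d g ≈V φ d h
  φ-cong d = relabel-cong (act d)

  φ-≡ : ∀ {d d'} → d ≡ d' → φ d ≈M φ d'
  φ-≡ ≡.refl g = ≈V-refl

  φ-⊛ : ∀ d d' → φ (d ⊛ d') ≈M (φ d · φ d')
  φ-⊛ d d' g = ≈V-trans (relabel-ext (act-⊛ d d') g) (≈V-sym (relabel-∘ (act d') (act d) g))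

  φ-e : φ e ≈M idM
  φ-e g = ≈V-trans (relabel-ext act-e g) (relabel-id g)

  φ-inverseˡ : ∀ d g → φ (inv d) (φ d g) ≈V g
  φ-inverseˡ d g = ≈V-trans (≈V-sym (φ-⊛ d (inv d) g)) (≈V-trans (φ-≡ (⊛-inverseʳ d) g) (φ-e g))

  φ-inverseʳ : ∀ d g → φ d (φ (inv d) g) ≈V g
  φ-inverseʳ d g = ≈V-trans (≈V-sym (φ-⊛ (inv d) d g)) (≈V-trans (φ-≡ (⊛-inverseˡ d) g) (φ-e g))

  φ-injective : GroupNotions.NonTrivial G → ∀ d d' → φ d ≈M φ d' → d ≡ d'
  φ-injective (x , x≉ε) d d' φd≈φd' = ⊛-inverse-unique d d' (act-trivial (d ⊛ inv d')
    (Faithfulness.relabel-faithful x x≉ε (s≤s (s≤s z≤n)) (act-injective (d ⊛ inv d')) λ g →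
      ≈V-trans (φ-⊛ d (inv d') g) (≈V-trans (φ-cong (inv d') (φd≈φd' g)) (φ-inverseˡ d' g))))

  ω≈φ-rotation : ω ≈M φ rotation
  ω≈φ-rotation g j = trans (ω-shifted g j) (∙-cong
    (⁻¹-cong (reflexive (≡.cong (pad g) (≡.sym (act-zero rotation)))))
    (reflexive (≡.trans (pad-maybe (next j)) (≡.cong (pad g) (≡.sym (act-rotation j))))))
    where
    pad-maybe : ∀ o → maybe g ε o ≡ pad g (maybe F.suc F.zero o)
    pad-maybe (just i) = ≡.refl
    pad-maybe nothing  = ≡.refl

  τ≈φ-reflection : τ ≈M φ reflection
  τ≈φ-reflection g j = trans (sym (ε⁻¹∙x≈x (g (opposite j)))) (∙-cong
    (⁻¹-cong (reflexive (≡.cong (pad g) (≡.sym (act-zero reflection)))))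
    (reflexive (≡.cong (pad g) (≡.sym (act-reflection j)))))

  PreservesAdj : (V → V) → Set (c ⊔ ℓ)
  PreservesAdj f = ∀ g h → Adj g h → Adj (f g) (f h)

  Adj-resp : ∀ {g g' h h'} → g ≈V g' → h ≈V h' → Adj g h → Adj g' h'
  Adj-resp g≈g' h≈h' = IsInS-resp (λ j → ∙-cong (h≈h' j) (⁻¹-cong (g≈g' j)))

  ^-preserves : ∀ {f} → PreservesAdj f → ∀ k → PreservesAdj (f ^ k)
  ^-preserves         f-pres zero    g h g∼h = g∼h
  ^-preserves {f = f} f-pres (suc k) g h g∼h = ^-preserves f-pres k (f g) (f h) (f-pres g h g∼h)

  τ-preserves-Adj : PreservesAdj τ
  τ-preserves-Adj g h = IsInS-reverse

  isAut : ∀ f d → f ≈M φ d → PreservesAdj f →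
          ∀ f⁻¹ → PreservesAdj f⁻¹ → (∀ g → f⁻¹ (f g) ≈V g) → IsAut f
  isAut f d f≈φd f-pres f⁻¹ f⁻¹-pres f⁻¹-inverse =
    (λ g h g≈h → ≈V-trans (f≈φd g) (≈V-trans (φ-cong d g≈h) (≈V-sym (f≈φd h)))) ,
    (λ g h fg≈fh → ≈V-trans (≈V-sym (φ-inverseˡ d g))
      (≈V-trans (φ-cong (inv d) (≈V-trans (≈V-sym (f≈φd g)) (≈V-trans fg≈fh (f≈φd h)))) (φ-inverseˡ d h))) ,
    (λ h → φ (inv d) h , ≈V-trans (f≈φd _) (φ-inverseʳ d h)) ,
    f-pres ,
    (λ g h fg∼fh → Adj-resp (f⁻¹-inverse g) (f⁻¹-inverse h) (f⁻¹-pres (f g) (f h) fg∼fh))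

  toℕ-mod : ∀ (a : Fin n) → toℕ a mod n ≡ a
  toℕ-mod a = toℕ-≋-injective (toℕ-mod-≋ (toℕ a))

  rotation-⊛-power : ∀ k → rotation ⊛ (k mod n , false) ≡ (suc k mod n , false)
  rotation-⊛-power k = D-≡ (begin
    toℕ (proj₁ (rotation ⊛ (k mod n , false)))  ≈⟨ ⊛-proj₁ rotation (k mod n , false) ⟩
    1 + toℕ (k mod n)                           ≈⟨ +-≋-cong (≋-refl {1}) (toℕ-mod-≋ k) ⟩
    suc k                                       ≈⟨ toℕ-mod-≋ (suc k) ⟨
    toℕ (suc k mod n)                           ∎) ≡.refl
    where open SetoidReasoning ≋-setoid

  ω-power : ∀ k → (ω ^ k) ≈M φ (k mod n , false)
  ω-power zero    g = ≈V-sym (≈V-trans (φ-≡ (≡.cong (_, false) (toℕ-mod F.zero)) g) (φ-e g))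
  ω-power (suc k) g = ≈V-trans (ω-power k (ω g)) (≈V-trans (φ-cong (k mod n , false) (ω≈φ-rotation g))
    (≈V-trans (≈V-sym (φ-⊛ rotation (k mod n , false) g)) (φ-≡ (rotation-⊛-power k) g)))

  ω-power-n : ∀ g → (ω ^ n) g ≈V g
  ω-power-n g = ≈V-trans (ω-power n g) (≈V-trans (φ-≡ (≡.cong (_, false) n-mod-n) g) (φ-e g))
    where
    n-mod-n : n mod n ≡ F.zero
    n-mod-n = toℕ-≋-injective (≋-trans (toℕ-mod-≋ n) n≋0)

  τ-involutive : ∀ g → τ (τ g) ≈V g
  τ-involutive g j = reflexive (≡.cong g (opposite-involutive j))

  module _ (nontrivial : GroupNotions.NonTrivial G) where

    τ≉id : ¬ (τ ≈M idM)
    τ≉id τ≈id = reflection≢e (φ-injective nontrivial reflection e φr≈φe)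
      where
      reflection≢e : reflection ≢ e
      reflection≢e ()
      φr≈φe : φ reflection ≈M φ e
      φr≈φe g = ≈V-trans (≈V-sym (τ≈φ-reflection g)) (≈V-trans (τ≈id g) (≈V-sym (φ-e g)))

    τ-order : HasOrder τ 2
    τ-order = s≤s z≤n , τ-involutive , not-earlier
      where
      not-earlier : ∀ i → 0 < i → i < 2 → ¬ ((τ ^ i) ≈M idM)
      not-earlier 1             _ _                = τ≉id
      not-earlier (suc (suc i)) _ (s≤s (s≤s ()))

    ωⁱ≈id⇒i≡0 : ∀ i → i < n → (ω ^ i) ≈M idM → i ≡ 0
    ωⁱ≈id⇒i≡0 i i<n ωⁱ≈id = begin
      i                      ≡⟨ m<n⇒m%n≡m i<n ⟨
      i % n                  ≡⟨ toℕ-fromℕ< (m%n<n i n) ⟨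
      toℕ (i mod n)          ≡⟨ ≡.cong (toℕ ∘ proj₁) i-mod-n≡e ⟩
      0                      ∎
      where
      open ≡.≡-Reasoning
      φi≈φe : φ (i mod n , false) ≈M φ e
      φi≈φe g = ≈V-trans (≈V-sym (ω-power i g)) (≈V-trans (ωⁱ≈id g) (≈V-sym (φ-e g)))
      i-mod-n≡e : (i mod n , false) ≡ e
      i-mod-n≡e = φ-injective nontrivial (i mod n , false) e φi≈φe

    ω-order : HasOrder ω n
    ω-order = s≤s z≤n , ω-power-n , λ i 0<i i<n ωⁱ≈id → <⇒≢ 0<i (≡.sym (ωⁱ≈id⇒i≡0 i i<n ωⁱ≈id))

  ω-power-Gen : ∀ k → Gen τ ω (ω ^ k)
  ω-power-Gen zero    = gen-id
  ω-power-Gen (suc k) = gen-mul gen-f₂ (ω-power-Gen k)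

  φ-Gen : ∀ d → Gen τ ω (φ d)
  φ-Gen (a , false) = gen-resp (ω-power-Gen (toℕ a))
    (λ g → ≈V-trans (ω-power (toℕ a) g) (φ-≡ (≡.cong (_, false) (toℕ-mod a)) g))
  φ-Gen (a , true) = gen-resp (gen-mul (φ-Gen (a , false)) gen-f₁)
    (λ g → ≈V-trans (τ≈φ-reflection (φ (a , false) g))
      (≈V-trans (≈V-sym (φ-⊛ (a , false) reflection g)) (φ-≡ rotate-then-reflect g)))
    where
    rotate-then-reflect : (a , false) ⊛ reflection ≡ (a , true)
    rotate-then-reflect =
      D-≡ (≋-trans (⊛-proj₁ (a , false) reflection) (≋-reflexive (+-identityʳ (toℕ a)))) ≡.refl

  Gen-φ : ∀ {f} → Gen τ ω f → ∃ λ d → φ d ≈M f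
  Gen-φ gen-id = e , φ-e
  Gen-φ gen-f₁ = reflection , λ g → ≈V-sym (τ≈φ-reflection g)
  Gen-φ gen-f₂ = rotation , λ g → ≈V-sym (ω≈φ-rotation g)
  Gen-φ (gen-mul {f} p q) with Gen-φ p | Gen-φ q
  ... | d , φd≈f | d' , φd'≈f' =
    d ⊛ d' , λ g → ≈V-trans (φ-⊛ d d' g) (≈V-trans (φ-cong d' (φd≈f g)) (φd'≈f' (f g)))
  Gen-φ (gen-inv {f} {f'} p ff'≈id f'f≈id) with Gen-φ p
  ... | d , φd≈f = inv d , λ g → ≈V-sym (≈V-trans (≈V-sym (φ-inverseˡ d (f' g)))
    (φ-cong (inv d) (≈V-trans (φd≈f (f' g)) (f'f≈id g))))
  Gen-φ (gen-resp p f≈f') with Gen-φ p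
  ... | d , φd≈f = d , λ g → ≈V-trans (φd≈f g) (f≈f' g)

lemma6p7 : ∀ {c ℓ} (G : Group c ℓ) → GroupNotions.IsFiniteGroup G → GroupNotions.NonTrivial G →
           (m : ℕ) → 2 ≤ m →
           let open Cayley G m in
           (IsAut τ × HasOrder τ 2)
           × (IsAut ω × HasOrder ω (suc m))
           × IsoToDihedral τ ω
lemma6p7 G _ nontrivial (suc (suc m₀)) (s≤s (s≤s z≤n)) =
  (isAut τ reflection τ≈φ-reflection τ-preserves-Adj τ τ-preserves-Adj τ-involutive , τ-order nontrivial) ,
  (isAut ω rotation ω≈φ-rotation ω-preserves-Adj (ω ^ m) (^-preserves ω-preserves-Adj m) ω-power-n ,
   ω-order nontrivial) ,
  (φ , φ-Gen , (λ _ → Gen-φ) , φ-injective nontrivial , φ-⊛)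
  where
  m = suc (suc m₀)
  open Cayley G m
  open DihedralAction G m₀
  open Rotation G (suc m₀) using (ω-preserves-Adj)
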